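{- For all positive integers $m,n$, \[\mathcal{I}_m(n)=m\,3^{n-1}-2\sum_{s=1}^{n-1}3^{n-s-1}\mathcal{D}(s,1),\] where $\mathcal{D}(s,1)$ is computed in the table with $m$ rows.
   Context: For positive integers $m,n$, $T_{m,n}$ is the table with $m$ rows and $n$ columns, with steps $(1,0),(1,1),(1,-1)$ (move one column right and stay, go up one row, or go down one row). $\mathcal{I}_m(n)$ is the number of sequences $(r_1,\dots,r_n)$ with $r_i\in\{1,\dots,m\}$ and $|r_{i+1}-r_i|\le1$ (perfect lattice paths from the first to the last column staying in the table). For $s\ge1$ and $1\le t\le m$, $\mathcal{D}(s,t)$ is the number of sequences $(r_1,\dots,r_s)$ with $r_i\in\{1,\dots,m\}$, $|r_{i+1}-r_i|\le1$, and $r_s=t$, i.e. the number of such paths in the $m$-row table from any cell of the first column to the cell in column $s$, row $t$. -}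

module Defs where

open import Data.Nat using (ℕ; zero; suc; _+_; _*_; _∸_; _^_; _≤_; _≤?_)
open import Data.List using (List; []; _∷_; map; concatMap; filter; length; upTo; allFin)
open import Data.Fin using (Fin; toℕ)
open import Data.Fin.Properties using (_≟_)
open import Data.Vec using (Vec; []; _∷_; last)
open import Relation.Nullary using (Dec; yes; no)
open import Relation.Nullary.Decidable using (_×-dec_)
open import Data.Product using (_×_; _,_)
open import Data.Unit using (⊤; tt)
open import Relation.Binary.PropositionalEquality using (_≡_)

-- Rows 1..m are represented by Fin m (row r ↦ toℕ r + 1).
-- All sequences (r₁,…,rₙ) with rᵢ ∈ {1,…,m}, as a list of vectors.
allSeqs : (m n : ℕ) → List (Vec (Fin m) n)
allSeqs m zero = [] ∷ []
allSeqs m (suc n) = concatMap (λ r → map (r ∷_) (allSeqs m n)) (allFin m)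

Adj : ℕ → ℕ → Set
Adj a b = (a ≤ suc b) × (b ≤ suc a)

adj? : (a b : ℕ) → Dec (Adj a b)
adj? a b = (a ≤? suc b) ×-dec (b ≤? suc a)

Steps : ∀ {m n} → Vec (Fin m) n → Set
Steps [] = ⊤
Steps (x ∷ []) = ⊤
Steps (x ∷ y ∷ v) = Adj (toℕ x) (toℕ y) × Steps (y ∷ v)

steps? : ∀ {m n} → (v : Vec (Fin m) n) → Dec (Steps v)
steps? [] = yes tt
steps? (x ∷ []) = yes tt
steps? (x ∷ y ∷ v) = adj? (toℕ x) (toℕ y) ×-dec steps? (y ∷ v)

I : (m n : ℕ) → ℕ
I m n = length (filter steps? (allSeqs m n))

-- D(s,t) in the m-row table: such sequences of length s with r_s = t.
-- Row t is given as t' : Fin m with t = toℕ t' + 1; s ≥ 1 is encoded as s = suc s'.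
EndsAt : ∀ {m s} → Fin m → Vec (Fin m) (suc s) → Set
EndsAt t v = Steps v × (last v ≡ t)

endsAt? : ∀ {m s} → (t : Fin m) → (v : Vec (Fin m) (suc s)) → Dec (EndsAt t v)
endsAt? t v = steps? v ×-dec (last v ≟ t)

D : (m s' : ℕ) → Fin m → ℕ
D m s' t = length (filter (endsAt? t) (allSeqs m (suc s')))

open import Data.Integer as Z using (ℤ)
sumℤ : ℕ → (ℕ → ℤ) → ℤ
sumℤ zero f = Z.+ 0
sumℤ (suc n) f = sumℤ n f Z.+ f n

-- Let wₙ(r) count the admissible sequences of length n + 1 starting in row r. Then wₙ = Aⁿ 1 for
-- the adjacency matrix A (loops included) of the path on the m rows, Iₘ(n + 1) = Σᵣ wₙ(r), and, A
-- being symmetric, D(n + 1, 1) = ⟨1, Aⁿ δ₁⟩ = ⟨Aⁿ 1, δ₁⟩ = wₙ(1). The column sums of A are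
-- 3 − [j = 1] − [j = m], so Σ A wₙ = 3 Σ wₙ − wₙ(1) − wₙ(m), and the reflection r ↦ m + 1 − r is an
-- automorphism of the path, so wₙ(m) = wₙ(1). Hence Iₘ(n + 2) = 3 Iₘ(n + 1) − 2 D(n + 1, 1), and
-- unrolling this recurrence from Iₘ(1) = m gives the formula.
module Submission where

open import Defs
open import Data.Nat using (ℕ; zero; suc; _∸_; _≤_; pred; z≤n; s≤s; s≤s⁻¹)
  renaming (_+_ to _+ℕ_; _*_ to _*ℕ_)
open import Data.Nat.Properties
  using (+-*-semiring; +-comm; +-assoc; *-comm; *-assoc; *-identityˡ; *-identityʳ; *-distribˡ-+;
         *-zeroʳ; +-identityʳ; n≤1+n; ≤-refl; ≤-trans; m∸n≤m; ∸-monoʳ-≤; pred-mono-≤; +-∸-assoc; n∸n≡0)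
open import Data.Nat.ListAction using () renaming (sum to sumᴸ)
open import Data.Nat.ListAction.Properties using () renaming (sum-++ to sumᴸ-++)
open import Data.List using (List; []; _∷_; _++_; map; filter; length; concatMap; tabulate; allFin)
open import Data.List.Properties using (map-++; map-cong; map-∘; map-tabulate)
open import Data.Vec using (Vec; _∷_; last)
open import Data.Vec.Functional using (Vector)
open import Data.Fin using (Fin; zero; suc; toℕ; fromℕ; opposite)
open import Data.Fin.Properties using (_≟_; opposite-prop; opposite-involutive)
open import Data.Fin.Permutation using (Permutation; _⟨$⟩ʳ_; reverse)
open import Data.Integer using (ℤ; +_; _+_; _-_; _*_; _^_)
import Data.Integer.Properties as ℤ
open import Data.Integer.Tactic.RingSolver using (solve-∀)
open import Data.Bool using (true; false; if_then_else_)
open import Data.Product using (_,_; swap)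
import Data.Product as Product
open import Function using (_∘_; _⇔_; mk⇔)
open import Relation.Nullary using (Dec; does)
open import Relation.Nullary.Decidable using (_×-dec_; does-⇔)
open import Relation.Binary.PropositionalEquality
  using (_≡_; _≗_; refl; sym; trans; cong; cong₂; subst₂; module ≡-Reasoning)
open import Algebra.Properties.Semiring.Sum +-*-semiring
  using (sum; sum-syntax; sum-cong-≗; sum-replicate-zero; ∑-comm; ∑-distrib-+;
         *-distribˡ-sum; *-distribʳ-sum; ∑-permute)

open ≡-Reasoning

ind : {P : Set} → Dec P → ℕ
ind d = if does d then 1 else 0

ind-× : {P Q : Set} (p : Dec P) (q : Dec Q) → ind (p ×-dec q) ≡ ind p *ℕ ind q
ind-× p q with does p | does q
... | true  | true  = refl
... | true  | false = refl
... | false | _     = refl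

ind-⇔ : {P Q : Set} → P ⇔ Q → (p : Dec P) (q : Dec Q) → ind p ≡ ind q
ind-⇔ P⇔Q p q = cong (λ b → if b then 1 else 0) (does-⇔ P⇔Q p q)

length-filter≡sum : {A : Set} {P : A → Set} (P? : ∀ x → Dec (P x)) (xs : List A) →
                    length (filter P? xs) ≡ sumᴸ (map (ind ∘ P?) xs)
length-filter≡sum P? []       = refl
length-filter≡sum P? (x ∷ xs) with does (P? x)
... | true  = cong suc (length-filter≡sum P? xs)
... | false = length-filter≡sum P? xs

sum-map-concatMap : {A B : Set} (f : B → ℕ) (g : A → List B) (xs : List A) →
                    sumᴸ (map f (concatMap g xs)) ≡ sumᴸ (map (sumᴸ ∘ map f ∘ g) xs)
sum-map-concatMap f g []       = refl
sum-map-concatMap f g (x ∷ xs) = begin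
  sumᴸ (map f (g x ++ concatMap g xs))
    ≡⟨ cong sumᴸ (map-++ f (g x) (concatMap g xs)) ⟩
  sumᴸ (map f (g x) ++ map f (concatMap g xs))
    ≡⟨ sumᴸ-++ (map f (g x)) _ ⟩
  sumᴸ (map f (g x)) +ℕ sumᴸ (map f (concatMap g xs))
    ≡⟨ cong (sumᴸ (map f (g x)) +ℕ_) (sum-map-concatMap f g xs) ⟩
  sumᴸ (map (sumᴸ ∘ map f ∘ g) (x ∷ xs))
    ∎

*-distribˡ-sum-map : {A : Set} (c : ℕ) (f : A → ℕ) (xs : List A) →
                     sumᴸ (map (λ x → c *ℕ f x) xs) ≡ c *ℕ sumᴸ (map f xs)
*-distribˡ-sum-map c f []       = sym (*-zeroʳ c)
*-distribˡ-sum-map c f (x ∷ xs) =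
  trans (cong (c *ℕ f x +ℕ_) (*-distribˡ-sum-map c f xs)) (sym (*-distribˡ-+ c (f x) _))

sum-tabulate : ∀ {m} (f : Fin m → ℕ) → sumᴸ (tabulate f) ≡ sum f
sum-tabulate {zero}  f = refl
sum-tabulate {suc m} f = cong (f zero +ℕ_) (sum-tabulate (f ∘ suc))

sum-map-allFin : ∀ {m} (f : Fin m → ℕ) → sumᴸ (map f (allFin m)) ≡ sum f
sum-map-allFin f = trans (cong sumᴸ (map-tabulate (λ i → i) f)) (sum-tabulate f)

sum-ones : ∀ m → ∑[ i < m ] 1 ≡ m
sum-ones zero    = refl
sum-ones (suc m) = cong suc (sum-ones m)

δ : ∀ {m} → Fin m → Vector ℕ m
δ k j = ind (j ≟ k)

⟨_,_⟩ : ∀ {m} → Vector ℕ m → Vector ℕ m → ℕ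
⟨_,_⟩ {m} u v = ∑[ i < m ] (u i *ℕ v i)

inner-congˡ : ∀ {m} {u u′ : Vector ℕ m} v → u ≗ u′ → ⟨ u , v ⟩ ≡ ⟨ u′ , v ⟩
inner-congˡ v u≗u′ = sum-cong-≗ (λ i → cong (_*ℕ v i) (u≗u′ i))

inner-+ʳ : ∀ {m} (u v v′ : Vector ℕ m) → ⟨ u , v ⟩ +ℕ ⟨ u , v′ ⟩ ≡ ⟨ u , (λ i → v i +ℕ v′ i) ⟩
inner-+ʳ u v v′ = trans (sym (∑-distrib-+ (λ i → u i *ℕ v i) (λ i → u i *ℕ v′ i)))
                        (sum-cong-≗ (λ i → sym (*-distribˡ-+ (u i) (v i) (v′ i))))

inner-δʳ : ∀ {m} (w : Vector ℕ m) k → ⟨ w , δ k ⟩ ≡ w k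
inner-δʳ {suc m} w zero    = begin
  w zero *ℕ 1 +ℕ ∑[ i < m ] (w (suc i) *ℕ 0)
    ≡⟨ cong₂ _+ℕ_ (*-identityʳ (w zero)) (sum-cong-≗ (λ i → *-zeroʳ (w (suc i)))) ⟩
  w zero +ℕ ∑[ i < m ] 0
    ≡⟨ cong (w zero +ℕ_) (sum-replicate-zero m) ⟩
  w zero +ℕ 0
    ≡⟨ +-identityʳ (w zero) ⟩
  w zero
    ∎
inner-δʳ {suc m} w (suc k) = cong₂ _+ℕ_ (*-zeroʳ (w zero)) (inner-δʳ (w ∘ suc) k)

module Matrix {m : ℕ} (A : Fin m → Fin m → ℕ) where

  apply : Vector ℕ m → Vector ℕ m
  apply w i = ∑[ j < m ] (A i j *ℕ w j)

  power : ℕ → Vector ℕ m → Vector ℕ m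
  power zero    w = w
  power (suc n) w = apply (power n w)

  apply-cong : ∀ {w w′} → w ≗ w′ → apply w ≗ apply w′
  apply-cong w≗w′ i = sum-cong-≗ (λ j → cong (A i j *ℕ_) (w≗w′ j))

  power-apply : ∀ n w → power n (apply w) ≗ apply (power n w)
  power-apply zero    w = λ _ → refl
  power-apply (suc n) w = apply-cong (power-apply n w)

  ∑-apply : ∀ w → sum (apply w) ≡ ⟨ w , (λ j → ∑[ i < m ] A i j) ⟩
  ∑-apply w = begin
    ∑[ i < m ] ∑[ j < m ] (A i j *ℕ w j)
      ≡⟨ ∑-comm (λ i j → A i j *ℕ w j) ⟩
    ∑[ j < m ] ∑[ i < m ] (A i j *ℕ w j)
      ≡⟨ sum-cong-≗ (λ j → sym (*-distribʳ-sum (w j) (λ i → A i j))) ⟩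
    ∑[ j < m ] ((∑[ i < m ] A i j) *ℕ w j)
      ≡⟨ sum-cong-≗ (λ j → *-comm _ (w j)) ⟩
    ⟨ w , (λ j → ∑[ i < m ] A i j) ⟩
      ∎

  module _ (A-sym : ∀ i j → A i j ≡ A j i) where

    apply-selfAdjoint : ∀ u v → ⟨ u , apply v ⟩ ≡ ⟨ apply u , v ⟩
    apply-selfAdjoint u v = begin
      ∑[ i < m ] (u i *ℕ ∑[ j < m ] (A i j *ℕ v j))
        ≡⟨ sum-cong-≗ (λ i → *-distribˡ-sum (u i) (λ j → A i j *ℕ v j)) ⟩
      ∑[ i < m ] ∑[ j < m ] (u i *ℕ (A i j *ℕ v j))
        ≡⟨ ∑-comm (λ i j → u i *ℕ (A i j *ℕ v j)) ⟩
      ∑[ j < m ] ∑[ i < m ] (u i *ℕ (A i j *ℕ v j))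
        ≡⟨ sum-cong-≗ (λ j → sum-cong-≗ (λ i → reassociate j i)) ⟩
      ∑[ j < m ] ∑[ i < m ] (A j i *ℕ u i *ℕ v j)
        ≡⟨ sum-cong-≗ (λ j → sym (*-distribʳ-sum (v j) (λ i → A j i *ℕ u i))) ⟩
      ⟨ apply u , v ⟩
        ∎
      where
      reassociate : ∀ j i → u i *ℕ (A i j *ℕ v j) ≡ A j i *ℕ u i *ℕ v j
      reassociate j i rewrite A-sym i j =
        sym (trans (cong (_*ℕ v j) (*-comm (A j i) (u i))) (*-assoc (u i) (A j i) (v j)))

    power-selfAdjoint : ∀ n u v → ⟨ u , power n v ⟩ ≡ ⟨ power n u , v ⟩
    power-selfAdjoint zero    u v = refl
    power-selfAdjoint (suc n) u v = begin
      ⟨ u , apply (power n v) ⟩ ≡⟨ apply-selfAdjoint u (power n v) ⟩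
      ⟨ apply u , power n v ⟩   ≡⟨ power-selfAdjoint n (apply u) v ⟩
      ⟨ power n (apply u) , v ⟩ ≡⟨ inner-congˡ v (power-apply n u) ⟩
      ⟨ apply (power n u) , v ⟩ ∎

  module _ (π : Permutation m m) (A-invariant : ∀ i j → A (π ⟨$⟩ʳ i) (π ⟨$⟩ʳ j) ≡ A i j) where

    apply-invariant : ∀ {w} → w ∘ (π ⟨$⟩ʳ_) ≗ w → apply w ∘ (π ⟨$⟩ʳ_) ≗ apply w
    apply-invariant {w} w-invariant i = begin
      ∑[ j < m ] (A (π ⟨$⟩ʳ i) j *ℕ w j)
        ≡⟨ ∑-permute _ π ⟩
      ∑[ j < m ] (A (π ⟨$⟩ʳ i) (π ⟨$⟩ʳ j) *ℕ w (π ⟨$⟩ʳ j))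
        ≡⟨ sum-cong-≗ (λ j → cong₂ _*ℕ_ (A-invariant i j) (w-invariant j)) ⟩
      ∑[ j < m ] (A i j *ℕ w j)
        ∎

    power-invariant : ∀ n {w} → w ∘ (π ⟨$⟩ʳ_) ≗ w → power n w ∘ (π ⟨$⟩ʳ_) ≗ power n w
    power-invariant zero    w-invariant = w-invariant
    power-invariant (suc n) w-invariant = apply-invariant (power-invariant n w-invariant)

adjacent : ∀ {m} → Fin m → Fin m → ℕ
adjacent i j = ind (adj? (toℕ i) (toℕ j))

adjacent-sym : ∀ {m} (i j : Fin m) → adjacent i j ≡ adjacent j i
adjacent-sym i j = ind-⇔ (mk⇔ swap swap) (adj? (toℕ i) (toℕ j)) (adj? (toℕ j) (toℕ i))

adjacent-suc : ∀ {m} (i j : Fin m) → adjacent (suc i) (suc j) ≡ adjacent i j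
adjacent-suc i j = ind-⇔ (mk⇔ (Product.map s≤s⁻¹ s≤s⁻¹) (Product.map s≤s s≤s))
                         (adj? (suc (toℕ i)) (suc (toℕ j))) (adj? (toℕ i) (toℕ j))

adjacent-zero-suc : ∀ {m} (j : Fin (suc m)) → adjacent zero (suc j) ≡ δ zero j
adjacent-zero-suc zero    = refl
adjacent-zero-suc (suc j) = refl

∸-pred-≤ : ∀ k b → k ∸ pred b ≤ suc (k ∸ b)
∸-pred-≤ k       zero          = n≤1+n k
∸-pred-≤ zero    (suc b)       = ≤-trans (m∸n≤m 0 b) z≤n
∸-pred-≤ (suc k) (suc zero)    = ≤-refl
∸-pred-≤ (suc k) (suc (suc b)) = ∸-pred-≤ k (suc b)

∸-antitone-≤-suc : ∀ k {a b} → b ≤ suc a → k ∸ a ≤ suc (k ∸ b)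
∸-antitone-≤-suc k {b = b} b≤1+a = ≤-trans (∸-monoʳ-≤ k (pred-mono-≤ b≤1+a)) (∸-pred-≤ k b)

Adj-∸ : ∀ k {a b} → Adj a b → Adj (k ∸ a) (k ∸ b)
Adj-∸ k (a≤1+b , b≤1+a) = ∸-antitone-≤-suc k b≤1+a , ∸-antitone-≤-suc k a≤1+b

Adj-opposite : ∀ {m} {i j : Fin m} → Adj (toℕ i) (toℕ j) → Adj (toℕ (opposite i)) (toℕ (opposite j))
Adj-opposite {suc m} {i} {j} = subst₂ Adj (sym (opposite-prop i)) (sym (opposite-prop j)) ∘ Adj-∸ m

adjacent-opposite : ∀ {m} (i j : Fin m) → adjacent (opposite i) (opposite j) ≡ adjacent i j
adjacent-opposite i j = ind-⇔ (mk⇔ back Adj-opposite)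
                              (adj? (toℕ (opposite i)) (toℕ (opposite j))) (adj? (toℕ i) (toℕ j))
  where
  back : Adj (toℕ (opposite i)) (toℕ (opposite j)) → Adj (toℕ i) (toℕ j)
  back = subst₂ (λ i′ j′ → Adj (toℕ i′) (toℕ j′)) (opposite-involutive i) (opposite-involutive j)
       ∘ Adj-opposite

column-degree : ∀ {m} (j : Fin (suc m)) → ∑[ i < suc m ] adjacent i j +ℕ δ zero j +ℕ δ (fromℕ m) j ≡ 3
column-degree {zero}  zero    = refl
-- adjacent i zero computes to 0 as soon as i ≥ 2.
column-degree {suc m} zero    = cong (λ s → suc (suc (s +ℕ 1 +ℕ 0))) (sum-replicate-zero m)
column-degree {suc m} (suc j) = begin
  adjacent zero (suc j) +ℕ ∑[ i < suc m ] adjacent (suc i) (suc j) +ℕ 0 +ℕ δ (fromℕ m) j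
    ≡⟨ cong₂ (λ a s → a +ℕ s +ℕ 0 +ℕ δ (fromℕ m) j)
             (adjacent-zero-suc j) (sum-cong-≗ (λ i → adjacent-suc i j)) ⟩
  δ zero j +ℕ ∑[ i < suc m ] adjacent i j +ℕ 0 +ℕ δ (fromℕ m) j
    ≡⟨ cong (_+ℕ δ (fromℕ m) j) (trans (+-identityʳ _) (+-comm (δ zero j) _)) ⟩
  ∑[ i < suc m ] adjacent i j +ℕ δ zero j +ℕ δ (fromℕ m) j
    ≡⟨ column-degree j ⟩
  3 ∎

module _ {m : ℕ} where

  open Matrix (adjacent {m})

  sumᴸ-allSeqs-suc : ∀ n (f : Vec (Fin m) (suc n) → ℕ) →
                     sumᴸ (map f (allSeqs m (suc n))) ≡ ∑[ r < m ] sumᴸ (map (f ∘ (r ∷_)) (allSeqs m n))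
  sumᴸ-allSeqs-suc n f = begin
    sumᴸ (map f (allSeqs m (suc n)))
      ≡⟨ sum-map-concatMap f (λ r → map (r ∷_) (allSeqs m n)) (allFin m) ⟩
    sumᴸ (map (λ r → sumᴸ (map f (map (r ∷_) (allSeqs m n)))) (allFin m))
      ≡⟨ sum-map-allFin (λ r → sumᴸ (map f (map (r ∷_) (allSeqs m n)))) ⟩
    ∑[ r < m ] sumᴸ (map f (map (r ∷_) (allSeqs m n)))
      ≡⟨ sum-cong-≗ (λ r → cong sumᴸ (sym (map-∘ {g = f} {f = r ∷_} (allSeqs m n)))) ⟩
    ∑[ r < m ] sumᴸ (map (f ∘ (r ∷_)) (allSeqs m n))
      ∎

  walks-from : ∀ n (r : Fin m) (w : Vector ℕ m) →
               sumᴸ (map (λ v → ind (steps? (r ∷ v)) *ℕ w (last (r ∷ v))) (allSeqs m n)) ≡ power n w r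
  walks-from zero    r w = trans (+-identityʳ _) (*-identityˡ (w r))
  walks-from (suc n) r w = begin
    sumᴸ (map (λ v → ind (steps? (r ∷ v)) *ℕ w (last (r ∷ v))) (allSeqs m (suc n)))
      ≡⟨ sumᴸ-allSeqs-suc n _ ⟩
    ∑[ j < m ] sumᴸ (map (λ v → ind (steps? (r ∷ j ∷ v)) *ℕ w (last (j ∷ v))) (allSeqs m n))
      ≡⟨ sum-cong-≗ first-step ⟩
    ∑[ j < m ] (adjacent r j *ℕ power n w j)
      ∎
    where
    first-step : ∀ j → sumᴸ (map (λ v → ind (steps? (r ∷ j ∷ v)) *ℕ w (last (j ∷ v))) (allSeqs m n))
                       ≡ adjacent r j *ℕ power n w j
    first-step j = begin
      sumᴸ (map (λ v → ind (steps? (r ∷ j ∷ v)) *ℕ w (last (j ∷ v))) (allSeqs m n))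
        ≡⟨ cong sumᴸ (map-cong split (allSeqs m n)) ⟩
      sumᴸ (map (λ v → adjacent r j *ℕ (ind (steps? (j ∷ v)) *ℕ w (last (j ∷ v)))) (allSeqs m n))
        ≡⟨ *-distribˡ-sum-map (adjacent r j) _ (allSeqs m n) ⟩
      adjacent r j *ℕ sumᴸ (map (λ v → ind (steps? (j ∷ v)) *ℕ w (last (j ∷ v))) (allSeqs m n))
        ≡⟨ cong (adjacent r j *ℕ_) (walks-from n j w) ⟩
      adjacent r j *ℕ power n w j
        ∎
      where
      split : ∀ v → ind (steps? (r ∷ j ∷ v)) *ℕ w (last (j ∷ v))
                    ≡ adjacent r j *ℕ (ind (steps? (j ∷ v)) *ℕ w (last (j ∷ v)))
      split v = trans (cong (_*ℕ w (last (j ∷ v))) (ind-× (adj? (toℕ r) (toℕ j)) (steps? (j ∷ v))))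
                      (*-assoc (adjacent r j) _ _)

  walks-weighted : ∀ n (w : Vector ℕ m) →
                   sumᴸ (map (λ v → ind (steps? v) *ℕ w (last v)) (allSeqs m (suc n))) ≡ sum (power n w)
  walks-weighted n w = trans (sumᴸ-allSeqs-suc n _) (sum-cong-≗ (λ r → walks-from n r w))

  I≡∑power : ∀ n → I m (suc n) ≡ sum (power n (λ _ → 1))
  I≡∑power n = begin
    length (filter steps? (allSeqs m (suc n)))
      ≡⟨ length-filter≡sum steps? (allSeqs m (suc n)) ⟩
    sumᴸ (map (ind ∘ steps?) (allSeqs m (suc n)))
      ≡⟨ cong sumᴸ (map-cong (λ v → sym (*-identityʳ (ind (steps? v)))) (allSeqs m (suc n))) ⟩
    sumᴸ (map (λ v → ind (steps? v) *ℕ 1) (allSeqs m (suc n)))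
      ≡⟨ walks-weighted n (λ _ → 1) ⟩
    sum (power n (λ _ → 1))
      ∎

  D≡∑power : ∀ n t → D m n t ≡ sum (power n (δ t))
  D≡∑power n t = begin
    length (filter (endsAt? t) (allSeqs m (suc n)))
      ≡⟨ length-filter≡sum (endsAt? t) (allSeqs m (suc n)) ⟩
    sumᴸ (map (ind ∘ endsAt? t) (allSeqs m (suc n)))
      ≡⟨ cong sumᴸ (map-cong (λ v → ind-× (steps? v) (last v ≟ t)) (allSeqs m (suc n))) ⟩
    sumᴸ (map (λ v → ind (steps? v) *ℕ δ t (last v)) (allSeqs m (suc n)))
      ≡⟨ walks-weighted n (δ t) ⟩
    sum (power n (δ t))
      ∎

module _ {m : ℕ} where

  open Matrix (adjacent {suc m})

  walks : ℕ → Vector ℕ (suc m)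
  walks n = power n (λ _ → 1)

  walks-opposite : ∀ n i → walks n (opposite i) ≡ walks n i
  walks-opposite n = power-invariant reverse adjacent-opposite n (λ _ → refl)

  D≡walks : ∀ n → D (suc m) n zero ≡ walks n zero
  D≡walks n = begin
    D (suc m) n zero                  ≡⟨ D≡∑power n zero ⟩
    sum (power n (δ zero))            ≡⟨ sum-cong-≗ (λ i → sym (*-identityˡ (power n (δ zero) i))) ⟩
    ⟨ (λ _ → 1) , power n (δ zero) ⟩ ≡⟨ power-selfAdjoint adjacent-sym n (λ _ → 1) (δ zero) ⟩
    ⟨ walks n , δ zero ⟩              ≡⟨ inner-δʳ (walks n) zero ⟩
    walks n zero                      ∎

  ∑-apply-boundary : ∀ w → sum (apply w) +ℕ w zero +ℕ w (fromℕ m) ≡ 3 *ℕ sum w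
  ∑-apply-boundary w = begin
    sum (apply w) +ℕ w zero +ℕ w (fromℕ m)
      ≡⟨ cong₂ _+ℕ_ (cong₂ _+ℕ_ (∑-apply w) (sym (inner-δʳ w zero))) (sym (inner-δʳ w (fromℕ m))) ⟩
    ⟨ w , column ⟩ +ℕ ⟨ w , δ zero ⟩ +ℕ ⟨ w , δ (fromℕ m) ⟩
      ≡⟨ cong (_+ℕ ⟨ w , δ (fromℕ m) ⟩) (inner-+ʳ w column (δ zero)) ⟩
    ⟨ w , (λ j → column j +ℕ δ zero j) ⟩ +ℕ ⟨ w , δ (fromℕ m) ⟩
      ≡⟨ inner-+ʳ w (λ j → column j +ℕ δ zero j) (δ (fromℕ m)) ⟩
    ⟨ w , (λ j → column j +ℕ δ zero j +ℕ δ (fromℕ m) j) ⟩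
      ≡⟨ sum-cong-≗ (λ j → cong (w j *ℕ_) (column-degree j)) ⟩
    ∑[ j < suc m ] (w j *ℕ 3)
      ≡⟨ sym (*-distribʳ-sum 3 w) ⟩
    sum w *ℕ 3
      ≡⟨ *-comm (sum w) 3 ⟩
    3 *ℕ sum w
      ∎
    where
    column : Vector ℕ (suc m)
    column j = ∑[ i < suc m ] adjacent i j

  I-recurrence : ∀ n → I (suc m) (2 +ℕ n) +ℕ 2 *ℕ D (suc m) n zero ≡ 3 *ℕ I (suc m) (suc n)
  I-recurrence n = begin
    I (suc m) (2 +ℕ n) +ℕ 2 *ℕ D (suc m) n zero
      ≡⟨ cong₂ (λ s d → s +ℕ 2 *ℕ d) (I≡∑power {suc m} (suc n)) (D≡walks n) ⟩
    sum (apply (walks n)) +ℕ 2 *ℕ walks n zero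
      ≡⟨ cong (sum (apply (walks n)) +ℕ_) (cong (walks n zero +ℕ_) (+-identityʳ (walks n zero))) ⟩
    sum (apply (walks n)) +ℕ (walks n zero +ℕ walks n zero)
      ≡⟨ sym (+-assoc (sum (apply (walks n))) (walks n zero) (walks n zero)) ⟩
    sum (apply (walks n)) +ℕ walks n zero +ℕ walks n zero
      -- opposite zero reduces to fromℕ m
      ≡⟨ cong (sum (apply (walks n)) +ℕ walks n zero +ℕ_) (sym (walks-opposite n zero)) ⟩
    sum (apply (walks n)) +ℕ walks n zero +ℕ walks n (fromℕ m)
      ≡⟨ ∑-apply-boundary (walks n) ⟩
    3 *ℕ sum (walks n)
      ≡⟨ cong (3 *ℕ_) (sym (I≡∑power {suc m} n)) ⟩
    3 *ℕ I (suc m) (suc n)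
      ∎

  I-one : I (suc m) 1 ≡ suc m
  I-one = trans (I≡∑power {suc m} 0) (sum-ones (suc m))

pos-isolate : ∀ k l {a b c} → a +ℕ k *ℕ b ≡ l *ℕ c → + a ≡ + l * + c - + k * + b
pos-isolate k l {a} {b} {c} eq = begin
  + a                                   ≡⟨ cancel (+ a) (+ k * + b) ⟩
  + a + + k * + b - + k * + b           ≡⟨ cong (λ z → + a + z - + k * + b) (ℤ.pos-* k b) ⟨
  + a + + (k *ℕ b) - + k * + b          ≡⟨ cong (_- + k * + b) (ℤ.pos-+ a (k *ℕ b)) ⟨
  + (a +ℕ k *ℕ b) - + k * + b           ≡⟨ cong (λ z → + z - + k * + b) eq ⟩
  + (l *ℕ c) - + k * + b                ≡⟨ cong (_- + k * + b) (ℤ.pos-* l c) ⟩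
  + l * + c - + k * + b                 ∎
  where
  cancel : ∀ x y → x ≡ x + y - y
  cancel = solve-∀

module _ (c : ℤ) (d : ℕ → ℤ) where

  convolution : ℕ → ℤ
  convolution n = sumℤ n (λ k → c ^ (n ∸ suc k) * d k)

  sumℤ-factor : ∀ {n} j → j ≤ n →
                sumℤ j (λ k → c ^ (n ∸ k) * d k) ≡ c * sumℤ j (λ k → c ^ (n ∸ suc k) * d k)
  sumℤ-factor zero    _ = sym (ℤ.*-zeroʳ c)
  sumℤ-factor {suc n} (suc j) (s≤s j≤n) = begin
    sumℤ j (λ k → c ^ (suc n ∸ k) * d k) + c ^ (suc n ∸ j) * d j
      ≡⟨ cong₂ _+_ (sumℤ-factor j (≤-trans j≤n (n≤1+n n))) (cong (λ e → c ^ e * d j) (+-∸-assoc 1 j≤n)) ⟩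
    c * S + c ^ suc (n ∸ j) * d j
      ≡⟨ factor c S (c ^ (n ∸ j)) (d j) ⟩
    c * (S + c ^ (n ∸ j) * d j)
      ∎
    where
    S : ℤ
    S = sumℤ j (λ k → c ^ (suc n ∸ suc k) * d k)
    factor : ∀ c s p x → c * s + (c * p) * x ≡ c * (s + p * x)
    factor = solve-∀

  convolution-suc : ∀ n → convolution (suc n) ≡ c * convolution n + d n
  convolution-suc n = cong₂ _+_ (sumℤ-factor n ≤-refl)
                                (trans (cong (λ e → c ^ e * d n) (n∸n≡0 n)) (ℤ.*-identityˡ (d n)))

  unroll : ∀ (b : ℤ) (x : ℕ → ℤ) → (∀ n → x (suc n) ≡ c * x n - b * d n) →
           ∀ n → x n ≡ x 0 * c ^ n - b * convolution n
  unroll b x step zero    = base (x 0) b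
    where
    base : ∀ x₀ b → x₀ ≡ x₀ * + 1 - b * + 0
    base = solve-∀
  unroll b x step (suc n) = begin
    x (suc n)
      ≡⟨ step n ⟩
    c * x n - b * d n
      ≡⟨ cong (λ z → c * z - b * d n) (unroll b x step n) ⟩
    c * (x 0 * c ^ n - b * convolution n) - b * d n
      ≡⟨ regroup c b (x 0) (c ^ n) (convolution n) (d n) ⟩
    x 0 * (c * c ^ n) - b * (c * convolution n + d n)
      ≡⟨ cong (λ z → x 0 * c ^ suc n - b * z) (convolution-suc n) ⟨
    x 0 * c ^ suc n - b * convolution (suc n)
      ∎
    where
    regroup : ∀ c b x₀ p t y → c * (x₀ * p - b * t) - b * y ≡ x₀ * (c * p) - b * (c * t + y)
    regroup = solve-∀

theorem2p4 : (m' n' : ℕ) →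
    + (I (suc m') (suc n'))
      ≡ (+ (suc m')) * (+ 3) ^ n' - (+ 2) * sumℤ n' (λ k → (+ 3) ^ (n' ∸ suc k) * + (D (suc m') k Fin.zero))
theorem2p4 m' n' = begin
  + I (suc m') (suc n')
    ≡⟨ unroll (+ 3) d (+ 2) (λ n → + I (suc m') (suc n)) recurrence n' ⟩
  + I (suc m') 1 * (+ 3) ^ n' - (+ 2) * convolution (+ 3) d n'
    ≡⟨ cong (λ i → + i * (+ 3) ^ n' - (+ 2) * convolution (+ 3) d n') (I-one {m'}) ⟩
  + suc m' * (+ 3) ^ n' - (+ 2) * convolution (+ 3) d n'
    ∎
  where
  d : ℕ → ℤ
  d k = + D (suc m') k zero
  recurrence : ∀ n → + I (suc m') (2 +ℕ n) ≡ + 3 * + I (suc m') (suc n) - + 2 * d n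
  recurrence n = pos-isolate 2 3 {b = D (suc m') n zero} {c = I (suc m') (suc n)} (I-recurrence n)
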